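{- Let $G$ be a simple undirected graph with $n$ vertices ($n\in\mathbb{N}$). Then $G$ is connected if and only if for every coding sequence $\beta(G,n)$ of $G$, the $\mathbb{Z}_2$-linear span of $\beta(G,n)$ equals $\mathbb{Z}_2^{n-1}$.
   Context: Coding sequences: for a simple graph $G=(V,E)$ with $n$ vertices, choose a labeling $V=\{v_0,\ldots,v_{n-1}\}$. For an edge $e=v_iv_j$ with $i>j$ let $f^\#(e)=(x_1,\ldots,x_{n-1})\in\mathbb{Z}_2^{n-1}$ with $x_k=1$ iff $n-i\le k\le n-j-1$ and $x_k=0$ otherwise. The coding sequence $\beta(G,n)$ for that labeling is the set $\{f^\#(e):e\in E\}$. -}

module Defs where

open import Data.Bool using (Bool; false; true; _∧_; _xor_)
open import Data.Nat using (ℕ; suc; _∸_; _≤ᵇ_; _<_)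
open import Data.Fin using (Fin; toℕ)
open import Data.Vec using (Vec; tabulate; replicate; zipWith)
open import Data.Product using (Σ; _×_; ∃-syntax)
open import Relation.Binary.PropositionalEquality using (_≡_)
open import Relation.Binary.Construct.Closure.ReflexiveTransitive using (Star)
open import Relation.Nullary using (¬_)
open import Function.Bundles using (_⤖_; Bijection)

record SimpleGraph (V : Set) : Set₁ where
  field
    Adj   : V → V → Set
    sym   : ∀ {u v} → Adj u v → Adj v u
    irrefl : ∀ {v} → ¬ Adj v v

open SimpleGraph public

Connected : {V : Set} → SimpleGraph V → Set
Connected {V} G = (u v : V) → Star (Adj G) u v

Z2Vec : ℕ → Set
Z2Vec m = Vec Bool m

_+ᵥ_ : ∀ {m} → Z2Vec m → Z2Vec m → Z2Vec m
_+ᵥ_ = zipWith _xor_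

0ᵥ : ∀ {m} → Z2Vec m
0ᵥ = replicate _ false

data Span {m : ℕ} (S : Z2Vec m → Set) : Z2Vec m → Set where
  span-zero : Span S 0ᵥ
  span-add  : ∀ {v w} → S v → Span S w → Span S (v +ᵥ w)

-- f#(v_i v_j) for i > j: coordinates indexed k = 1..n-1 (Fin index t ↦ k = t+1),
-- x_k = 1 iff n-i ≤ k ≤ n-j-1.
codeVec : (n : ℕ) → Fin n → Fin n → Z2Vec (n ∸ 1)
codeVec n i j = tabulate λ t →
  ((n ∸ toℕ i) ≤ᵇ suc (toℕ t)) ∧ (suc (toℕ t) ≤ᵇ (n ∸ toℕ j ∸ 1))

-- The coding sequence β(G,n) for a labeling ℓ : Fin n ⤖ V (v_i = ℓ i), as a set.
β : {V : Set} (n : ℕ) → SimpleGraph V → (Fin n ⤖ V) → Z2Vec (n ∸ 1) → Set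
β n G ℓ x = ∃[ i ] ∃[ j ] (toℕ j < toℕ i × Adj G (f i) (f j) × x ≡ codeVec n i j)
  where f = Bijection.to ℓ

module Submission where

-- Give vertex v_a the "vertex code" vcode a = (0,…,0,1,…,1) ∈ Z₂^m whose ones
-- start at position θ a = m − a.  The code of an edge v_i v_j is then
-- vcode i + vcode j (codeVec-split), vertex v_0 has code 0, and the codes of
-- v_1,…,v_m are the prefix vectors, a basis of Z₂^m.
--
-- (⇒) Along a walk the edge codes telescope, so a walk from v_a to v_0 puts
--     vcode a into the span; these are all prefix vectors, which generate
--     everything (prefixes-generate).
-- (⇐) Write vcode u as a sum of edge codes over a list of edges.  The discrete
--     derivative Δ reads off basis coordinates, so this list has odd degree
--     at u and even degree at every other vertex except possibly v_0.  Such
--     an edge list always contains a walk from u to v_0 (odd-walk), and any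
--     two vertices are joined through v_0.

open import Defs hiding (sym)
open import Data.Nat using (ℕ; zero; suc; _∸_; _≤_; _<_; _≤ᵇ_; _<ᵇ_; z≤n; s≤s)
import Data.Nat.Properties as ℕ
open import Data.Fin using (Fin; toℕ; fromℕ<) renaming (zero to fz; suc to fs)
import Data.Fin.Properties as Fin
open import Data.Bool using (Bool; true; false; not; _∧_; _xor_)
open import Data.Bool.Properties using (xor-assoc; xor-comm; xor-same; xor-identityʳ; xor-∧-commutativeRing)
open import Data.Vec using (Vec; []; _∷_; tabulate)
open import Data.Vec.Properties using (tabulate-cong)
open import Data.Vec.Relation.Binary.Pointwise.Inductive
  using (Pointwise-≡⇒≡; zipWith-assoc; zipWith-comm; zipWith-identityˡ; zipWith-identityʳ)
open import Data.List using (List; []; _∷_; length)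
open import Data.Product using (Σ; _,_; proj₁; _×_)
open import Data.Empty using (⊥-elim)
open import Function using (_on_)
open import Function.Bundles using (_⤖_; _⇔_; Bijection; mk⇔)
open import Algebra.Bundles using (CommutativeRing; AbelianGroup)
open import Relation.Binary using (Rel; Symmetric; tri<; tri≈; tri>)
open import Relation.Binary.Definitions using (DecidableEquality)
open import Relation.Binary.PropositionalEquality
  using (_≡_; _≢_; refl; sym; trans; cong; cong₂; subst; module ≡-Reasoning)
open import Relation.Binary.Construct.Closure.ReflexiveTransitive using (Star; ε; _◅_; _◅◅_; reverse; gmap)
open import Relation.Nullary using (yes; no; does)
open import Relation.Nullary.Decidable using (dec-true; dec-false)

xor-abelianGroup : AbelianGroup _ _
xor-abelianGroup = CommutativeRing.+-abelianGroup xor-∧-commutativeRing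

open import Algebra.Properties.CommutativeSemigroup (AbelianGroup.commutativeSemigroup xor-abelianGroup)
  using (interchange; x∙yz≈y∙xz)
open import Algebra.Properties.AbelianGroup xor-abelianGroup using (xyx⁻¹≈y)

xor-cancelˡ : ∀ x y → x xor (x xor y) ≡ y
xor-cancelˡ x y = trans (sym (xor-assoc x x y)) (cong (_xor y) (xor-same x))

+ᵥ-assoc : ∀ {m} (u v w : Z2Vec m) → (u +ᵥ v) +ᵥ w ≡ u +ᵥ (v +ᵥ w)
+ᵥ-assoc u v w = Pointwise-≡⇒≡ (zipWith-assoc xor-assoc u v w)

+ᵥ-comm : ∀ {m} (v w : Z2Vec m) → v +ᵥ w ≡ w +ᵥ v
+ᵥ-comm v w = Pointwise-≡⇒≡ (zipWith-comm xor-comm v w)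

+ᵥ-identityˡ : ∀ {m} (v : Z2Vec m) → 0ᵥ +ᵥ v ≡ v
+ᵥ-identityˡ v = Pointwise-≡⇒≡ (zipWith-identityˡ (λ _ → refl) v)

+ᵥ-identityʳ : ∀ {m} (v : Z2Vec m) → v +ᵥ 0ᵥ ≡ v
+ᵥ-identityʳ v = Pointwise-≡⇒≡ (zipWith-identityʳ xor-identityʳ v)

+ᵥ-self : ∀ {m} (v : Z2Vec m) → v +ᵥ v ≡ 0ᵥ
+ᵥ-self [] = refl
+ᵥ-self (b ∷ v) = cong₂ _∷_ (xor-same b) (+ᵥ-self v)

+ᵥ-cancelˡ : ∀ {m} (v w : Z2Vec m) → v +ᵥ (v +ᵥ w) ≡ w
+ᵥ-cancelˡ v w = begin
  v +ᵥ (v +ᵥ w)  ≡⟨ sym (+ᵥ-assoc v v w) ⟩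
  (v +ᵥ v) +ᵥ w  ≡⟨ cong (_+ᵥ w) (+ᵥ-self v) ⟩
  0ᵥ +ᵥ w        ≡⟨ +ᵥ-identityˡ w ⟩
  w              ∎
  where open ≡-Reasoning

+ᵥ-telescope : ∀ {m} (u v w : Z2Vec m) → (u +ᵥ v) +ᵥ (v +ᵥ w) ≡ u +ᵥ w
+ᵥ-telescope u v w = trans (+ᵥ-assoc u v (v +ᵥ w)) (cong (u +ᵥ_) (+ᵥ-cancelˡ v w))

Span-single : ∀ {m} {S : Z2Vec m → Set} {v} → S v → Span S v
Span-single {v = v} s = subst (Span _) (+ᵥ-identityʳ v) (span-add s span-zero)

Span-+ : ∀ {m} {S : Z2Vec m → Set} {v w} → Span S v → Span S w → Span S (v +ᵥ w)
Span-+ {w = w} span-zero q = subst (Span _) (sym (+ᵥ-identityˡ w)) q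
Span-+ {w = w} (span-add {v = u} {w = v} s p) q =
  subst (Span _) (sym (+ᵥ-assoc u v w)) (span-add s (Span-+ p q))

prefix : (m s : ℕ) → Z2Vec m
prefix zero s = []
prefix (suc m) zero = true ∷ prefix m zero
prefix (suc m) (suc s) = false ∷ prefix m s

prefix-full : ∀ m → prefix m m ≡ 0ᵥ
prefix-full zero = refl
prefix-full (suc m) = cong (false ∷_) (prefix-full m)

prefix-tabulate : ∀ m s → prefix m s ≡ tabulate (λ t → s <ᵇ suc (toℕ t))
prefix-tabulate zero s = refl
prefix-tabulate (suc m) zero = cong (true ∷_) (prefix-tabulate m zero)
prefix-tabulate (suc m) (suc s) = cong (false ∷_) (prefix-tabulate m s)

prefixes-generate : ∀ m (P : Z2Vec m → Set) → P 0ᵥ →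
  (∀ {v w} → P v → P w → P (v +ᵥ w)) → (∀ s → s ≤ m → P (prefix m s)) → ∀ w → P w
prefixes-generate zero P p0 p+ pre [] = p0
prefixes-generate (suc m) P p0 p+ pre (b ∷ w) = head b
  where
  tail-zero : ∀ w → P (false ∷ w)
  tail-zero = prefixes-generate m (λ w → P (false ∷ w)) p0 p+ (λ s s≤m → pre (suc s) (s≤s s≤m))

  -- a leading one is split off with the all-ones prefix: true ∷ w = prefix 0 + (false ∷ (ones + w))
  head : ∀ b → P (b ∷ w)
  head false = tail-zero w
  head true = subst P (cong (true ∷_) (+ᵥ-cancelˡ (prefix m zero) w))
                (p+ (pre zero z≤n) (tail-zero (prefix m zero +ᵥ w)))

tabulate-xor : ∀ {k} (f g : Fin k → Bool) → tabulate (λ t → f t xor g t) ≡ tabulate f +ᵥ tabulate g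
tabulate-xor {zero} f g = refl
tabulate-xor {suc k} f g = cong ((f fz xor g fz) ∷_) (tabulate-xor (λ t → f (fs t)) (λ t → g (fs t)))

<ᵇ-complement : ∀ t s → (t <ᵇ s) ≡ not (s <ᵇ suc t)
<ᵇ-complement t zero = refl
<ᵇ-complement zero (suc s) = refl
<ᵇ-complement (suc t) (suc s) = <ᵇ-complement t s

interval-xor : ∀ s₁ s₂ t → s₁ ≤ s₂ →
  ((s₁ <ᵇ suc t) ∧ (t <ᵇ s₂)) ≡ ((s₁ <ᵇ suc t) xor (s₂ <ᵇ suc t))
interval-xor zero s₂ t _ = <ᵇ-complement t s₂
interval-xor (suc s₁) (suc s₂) zero _ = refl
interval-xor (suc s₁) (suc s₂) (suc t) (s≤s s₁≤s₂) = interval-xor s₁ s₂ t s₁≤s₂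

-- The discrete derivative Δ w k = w_k + w_(k-1): it sends prefix m s to
-- the k-th indicator, so it reads off coordinates in the prefix basis.

coord : ∀ {m} → Z2Vec m → ℕ → Bool
coord [] _ = false
coord (b ∷ v) zero = b
coord (b ∷ v) (suc k) = coord v k

Δ : ∀ {m} → Z2Vec m → ℕ → Bool
Δ w zero = coord w zero
Δ w (suc k) = coord w (suc k) xor coord w k

coord-+ : ∀ {m} (v w : Z2Vec m) k → coord (v +ᵥ w) k ≡ coord v k xor coord w k
coord-+ [] [] k = refl
coord-+ (a ∷ v) (b ∷ w) zero = refl
coord-+ (a ∷ v) (b ∷ w) (suc k) = coord-+ v w k

coord-0 : ∀ {m} k → coord (0ᵥ {m}) k ≡ false
coord-0 {zero} k = refl
coord-0 {suc m} zero = refl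
coord-0 {suc m} (suc k) = coord-0 {m} k

Δ-+ : ∀ {m} (v w : Z2Vec m) k → Δ (v +ᵥ w) k ≡ Δ v k xor Δ w k
Δ-+ v w zero = coord-+ v w zero
Δ-+ v w (suc k) = begin
  coord (v +ᵥ w) (suc k) xor coord (v +ᵥ w) k
    ≡⟨ cong₂ _xor_ (coord-+ v w (suc k)) (coord-+ v w k) ⟩
  (coord v (suc k) xor coord w (suc k)) xor (coord v k xor coord w k)
    ≡⟨ interchange (coord v (suc k)) (coord w (suc k)) (coord v k) (coord w k) ⟩
  Δ v (suc k) xor Δ w (suc k) ∎
  where open ≡-Reasoning

Δ-0 : ∀ {m} k → Δ (0ᵥ {m}) k ≡ false
Δ-0 {m} zero = coord-0 {m} zero
Δ-0 {m} (suc k) = cong₂ _xor_ (coord-0 {m} (suc k)) (coord-0 {m} k)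

Δ-shift : ∀ {m} (v : Z2Vec m) k → Δ (false ∷ v) (suc k) ≡ Δ v k
Δ-shift v zero = xor-identityʳ (coord v zero)
Δ-shift v (suc k) = refl

Δ-prefix : ∀ m s k → k < m → Δ (prefix m s) k ≡ does (s ℕ.≟ k)
Δ-prefix (suc m) zero zero _ = refl
Δ-prefix (suc zero) zero (suc k) (s≤s ())
Δ-prefix (suc (suc m)) zero (suc zero) _ = refl
Δ-prefix (suc (suc m)) zero (suc (suc k)) (s≤s k<m) = Δ-prefix (suc m) zero (suc k) k<m
Δ-prefix (suc m) (suc s) zero _ = refl
Δ-prefix (suc m) (suc s) (suc k) (s≤s k<m) = trans (Δ-shift (prefix m s) k) (Δ-prefix m s k k<m)

module VertexCode (m : ℕ) where

  θ : Fin (suc m) → ℕ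
  θ a = m ∸ toℕ a

  vcode : Fin (suc m) → Z2Vec m
  vcode a = prefix m (θ a)

  vcode-root : vcode fz ≡ 0ᵥ
  vcode-root = prefix-full m

  toℕ≤m : (a : Fin (suc m)) → toℕ a ≤ m
  toℕ≤m a = ℕ.≤-pred (Fin.toℕ<n a)

  θ-injective : ∀ {a b} → θ a ≡ θ b → a ≡ b
  θ-injective {a} {b} eq = Fin.toℕ-injective (ℕ.∸-cancelˡ-≡ (toℕ≤m a) (toℕ≤m b) eq)

  vcode-onto : ∀ {s} → s ≤ m → Σ (Fin (suc m)) λ a → vcode a ≡ prefix m s
  vcode-onto {s} s≤m = a , cong (prefix m) θa≡s
    where
    a : Fin (suc m)
    a = fromℕ< (s≤s (ℕ.m∸n≤m m s))
    θa≡s : θ a ≡ s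
    θa≡s = trans (cong (m ∸_) (Fin.toℕ-fromℕ< (s≤s (ℕ.m∸n≤m m s)))) (ℕ.m∸[m∸n]≡n s≤m)

  θ<m : ∀ {x} → x ≢ fz → θ x < m
  θ<m {fz} x≢fz = ⊥-elim (x≢fz refl)
  θ<m {fs {zero} ()} _
  θ<m {fs {suc k} y} _ = s≤s (ℕ.m∸n≤m k (toℕ y))

  Δ-vcode : ∀ a {x} → x ≢ fz → Δ (vcode a) (θ x) ≡ does (a Fin.≟ x)
  Δ-vcode a {x} x≢fz with a Fin.≟ x
  ... | yes refl = trans (Δ-prefix m (θ a) (θ a) (θ<m x≢fz)) (dec-true (θ a ℕ.≟ θ a) refl)
  ... | no a≢x =
    trans (Δ-prefix m (θ a) (θ x) (θ<m x≢fz)) (dec-false (θ a ℕ.≟ θ x) (λ eq → a≢x (θ-injective eq)))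

  codeVec-split : ∀ {i j} → toℕ j < toℕ i → codeVec (suc m) i j ≡ vcode i +ᵥ vcode j
  codeVec-split {i} {j} j<i = begin
    codeVec (suc m) i j
      ≡⟨ tabulate-cong (λ t → cong₂ (λ p q → (p ≤ᵇ suc (toℕ t)) ∧ (suc (toℕ t) ≤ᵇ q ∸ 1))
                                    (succ-θ i) (succ-θ j)) ⟩
    tabulate (λ t → (θ i <ᵇ suc (toℕ t)) ∧ (toℕ t <ᵇ θ j))
      ≡⟨ tabulate-cong (λ t → interval-xor (θ i) (θ j) (toℕ t) θi≤θj) ⟩
    tabulate (λ t → (θ i <ᵇ suc (toℕ t)) xor (θ j <ᵇ suc (toℕ t)))
      ≡⟨ tabulate-xor _ _ ⟩
    tabulate (λ t → θ i <ᵇ suc (toℕ t)) +ᵥ tabulate (λ t → θ j <ᵇ suc (toℕ t))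
      ≡⟨ sym (cong₂ _+ᵥ_ (prefix-tabulate m (θ i)) (prefix-tabulate m (θ j))) ⟩
    vcode i +ᵥ vcode j ∎
    where
    open ≡-Reasoning
    succ-θ : ∀ a → suc m ∸ toℕ a ≡ suc (θ a)
    succ-θ a = ℕ.+-∸-assoc 1 (toℕ≤m a)
    θi≤θj : θ i ≤ θ j
    θi≤θj = ℕ.∸-monoʳ-≤ m (ℕ.<⇒≤ j<i)

lift-walk : ∀ {a b r} {A : Set a} {B : Set b} {R : Rel B r} (ℓ : A ⤖ B) →
  let f = Bijection.to ℓ in ∀ {x y} → Star R (f x) (f y) → Star (R on f) x y
lift-walk {R = R} ℓ w = go w _ _ refl refl
  where
  open Bijection ℓ using (to; injective; strictlySurjective)
  go : ∀ {p q} → Star R p q → ∀ x y → to x ≡ p → to y ≡ q → Star (R on to) x y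
  go ε x y refl eq = subst (Star _ x) (sym (injective eq)) ε
  go (_◅_ {j = p} r rs) x y refl eq with strictlySurjective p
  ... | z , refl = r ◅ go rs z y refl eq

-- If every edge of R lies over a vector in the span, so does every walk:
-- the edge vectors telescope.
walk-span : ∀ {a r m} {A : Set a} {R : Rel A r} {S : Z2Vec m → Set} (vc : A → Z2Vec m) →
  (∀ {x y} → R x y → Span S (vc x +ᵥ vc y)) → ∀ {x y} → Star R x y → Span S (vc x +ᵥ vc y)
walk-span vc edge ε = subst (Span _) (sym (+ᵥ-self _)) span-zero
walk-span vc edge (_◅_ {i = x} {j = y} r rs) =
  subst (Span _) (+ᵥ-telescope (vc x) (vc y) _) (Span-+ (edge r) (walk-span vc edge rs))

-- Euler's parity argument: an edge list in which u is the only odd vertex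
-- (apart from a distinguished vertex z) contains a walk from u to z.
module OddWalk {a r} {A : Set a} (_≟_ : DecidableEquality A) (R : Rel A r) (R-sym : Symmetric R) where

  Edge : Set _
  Edge = Σ A λ u → Σ A λ v → R u v

  -- whether e has an odd number of endpoints at x
  touches : Edge → A → Bool
  touches (u , v , _) x = does (u ≟ x) xor does (v ≟ x)

  parity : List Edge → A → Bool
  parity [] x = false
  parity (e ∷ L) x = touches e x xor parity L x

  remove-odd : ∀ L u → parity L u ≡ true →
    Σ A λ v → Σ (R u v) λ h → Σ (List Edge) λ L′ →
      length L ≡ suc (length L′) × (∀ x → parity L x ≡ touches (u , v , h) x xor parity L′ x)
  remove-odd [] u ()
  remove-odd ((p , q , h) ∷ L) u odd with p ≟ u | q ≟ u
  ... | yes refl | _ = q , h , L , refl , λ x → refl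
  ... | no _ | yes refl =
    p , R-sym h , L , refl , λ x → cong (_xor parity L x) (xor-comm (does (p ≟ x)) (does (q ≟ x)))
  ... | no _ | no _ with remove-odd L u odd
  ...   | v , h′ , L′ , len , split =
    v , h′ , (p , q , h) ∷ L′ , cong suc len ,
    λ x → trans (cong (touches (p , q , h) x xor_) (split x))
                (x∙yz≈y∙xz (touches (p , q , h) x) (touches (u , v , h′) x) (parity L′ x))

  OnlyOdd : List Edge → A → A → Set a
  OnlyOdd L u z = ∀ x → x ≢ z → parity L x ≡ does (u ≟ x)

  odd-walk : ∀ L u z → OnlyOdd L u z → Star R u z
  odd-walk L = go (length L) L refl
    where
    step : ∀ {L L′ u v} (h : R u v) → (∀ x → parity L x ≡ touches (u , v , h) x xor parity L′ x) →
           ∀ {z} → OnlyOdd L u z → OnlyOdd L′ v z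
    step {L} {L′} {u} {v} h split only x x≢z = begin
      parity L′ x
        ≡⟨ sym (xor-cancelˡ t (parity L′ x)) ⟩
      t xor (t xor parity L′ x)
        ≡⟨ cong (t xor_) (sym (split x)) ⟩
      t xor parity L x
        ≡⟨ cong (t xor_) (only x x≢z) ⟩
      (does (u ≟ x) xor does (v ≟ x)) xor does (u ≟ x)
        ≡⟨ xyx⁻¹≈y (does (u ≟ x)) (does (v ≟ x)) ⟩
      does (v ≟ x) ∎
      where
      open ≡-Reasoning
      t : Bool
      t = touches (u , v , h) x

    go : ∀ n L → length L ≡ n → ∀ u z → OnlyOdd L u z → Star R u z
    go n L len u z only with u ≟ z
    ... | yes refl = ε
    ... | no u≢z with remove-odd L u (trans (only u u≢z) (dec-true (u ≟ u) refl))
    go zero L len u z only | no _ | _ , _ , _ , len′ , _ with trans (sym len) len′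
    ... | ()
    go (suc n) L len u z only | no _ | v , h , L′ , len′ , split =
      h ◅ go n L′ (ℕ.suc-injective (trans (sym len′) len)) v z (step {L} {L′} h split only)

module Labelled {V : Set} (m : ℕ) (ℓ : Fin (suc m) ⤖ V) (G : SimpleGraph V) where
  open VertexCode m

  f : Fin (suc m) → V
  f = Bijection.to ℓ

  H : Rel (Fin (suc m)) _
  H = Adj G on f

  S : Z2Vec m → Set
  S = β (suc m) G ℓ

  open OddWalk Fin._≟_ H (SimpleGraph.sym G)

  edge-span : ∀ {a b} → H a b → Span S (vcode a +ᵥ vcode b)
  edge-span {a} {b} h with Fin.<-cmp a b
  ... | tri< a<b _ _ = Span-single (b , a , a<b , SimpleGraph.sym G h ,
                          trans (+ᵥ-comm (vcode a) (vcode b)) (sym (codeVec-split a<b)))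
  ... | tri≈ _ refl _ = ⊥-elim (irrefl G h)
  ... | tri> _ _ b<a = Span-single (a , b , b<a , h , sym (codeVec-split b<a))

  connected⇒spanning : Connected G → ∀ w → Span S w
  connected⇒spanning conn = prefixes-generate m (Span S) span-zero Span-+ prefix-spanned
    where
    vcode-spanned : ∀ a → Span S (vcode a)
    vcode-spanned a = subst (Span S) (trans (cong (vcode a +ᵥ_) vcode-root) (+ᵥ-identityʳ (vcode a)))
                        (walk-span vcode edge-span (lift-walk ℓ (conn (f a) (f fz))))
    prefix-spanned : ∀ s → s ≤ m → Span S (prefix m s)
    prefix-spanned s s≤m with vcode-onto s≤m
    ... | a , eq = subst (Span S) eq (vcode-spanned a)

  edgeSum : List Edge → Z2Vec m
  edgeSum [] = 0ᵥ
  edgeSum ((a , b , _) ∷ L) = (vcode a +ᵥ vcode b) +ᵥ edgeSum L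

  span-edges : ∀ {w} → Span S w → Σ (List Edge) λ L → w ≡ edgeSum L
  span-edges span-zero = [] , refl
  span-edges (span-add (i , j , j<i , h , refl) p) with span-edges p
  ... | L , eq = (i , j , h) ∷ L , cong₂ _+ᵥ_ (codeVec-split j<i) eq

  Δ-edgeSum : ∀ L {x} → x ≢ fz → Δ (edgeSum L) (θ x) ≡ parity L x
  Δ-edgeSum [] {x} _ = Δ-0 (θ x)
  Δ-edgeSum ((a , b , h) ∷ L) {x} x≢fz = begin
    Δ ((vcode a +ᵥ vcode b) +ᵥ edgeSum L) (θ x)
      ≡⟨ Δ-+ (vcode a +ᵥ vcode b) (edgeSum L) (θ x) ⟩
    Δ (vcode a +ᵥ vcode b) (θ x) xor Δ (edgeSum L) (θ x)
      ≡⟨ cong₂ _xor_ (Δ-+ (vcode a) (vcode b) (θ x)) (Δ-edgeSum L x≢fz) ⟩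
    (Δ (vcode a) (θ x) xor Δ (vcode b) (θ x)) xor parity L x
      ≡⟨ cong (_xor parity L x) (cong₂ _xor_ (Δ-vcode a x≢fz) (Δ-vcode b x≢fz)) ⟩
    parity ((a , b , h) ∷ L) x ∎
    where open ≡-Reasoning

  walk-to-root : (∀ w → Span S w) → ∀ u → Star (Adj G) (f u) (f fz)
  walk-to-root spans u with span-edges (spans (vcode u))
  ... | L , eq = gmap f (λ h → h) (odd-walk L u fz only-u)
    where
    only-u : OnlyOdd L u fz
    only-u x x≢fz = trans (sym (Δ-edgeSum L x≢fz)) (trans (cong (λ v → Δ v (θ x)) (sym eq)) (Δ-vcode u x≢fz))

  spanning⇒connected : (∀ w → Span S w) → Connected G
  spanning⇒connected spans p q
    with Bijection.strictlySurjective ℓ p | Bijection.strictlySurjective ℓ q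
  ... | x , refl | y , refl = walk-to-root spans x ◅◅ reverse (SimpleGraph.sym G) (walk-to-root spans y)

corollary5 : {V : Set} (n : ℕ) (ℓ₀ : Fin n ⤖ V) (G : SimpleGraph V) →
    Connected G ⇔ ((ℓ : Fin n ⤖ V) → (w : Z2Vec (n ∸ 1)) → Span (β n G ℓ) w)
-- With no vertices both sides hold trivially.
corollary5 zero ℓ₀ G = mk⇔ (λ _ _ → λ { [] → span-zero }) (λ _ p → no-vertex (proj₁ (Bijection.strictlySurjective ℓ₀ p)))
  where
  no-vertex : ∀ {A : Set} → Fin zero → A
  no-vertex ()
corollary5 (suc m) ℓ₀ G =
  mk⇔ (λ conn ℓ → Labelled.connected⇒spanning m ℓ G conn)
      (λ spans → Labelled.spanning⇒connected m ℓ₀ G (spans ℓ₀))
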